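{- Let $T$ be a tree on $n\ge 6$ vertices. Then at least one of the following holds: (i) there is a non-leaf vertex $v$ of $T$ that is adjacent to exactly one non-leaf vertex $u$, such that deleting $v$ and all leaves adjacent to $v$ yields a tree $T'$ that either has at least 6 vertices or is a non-star on 5 vertices; (ii) there are two vertex-disjoint edges of $T$ such that every other edge of $T$ shares a vertex with at least one of them, and moreover there are also two edges of $T$ sharing a vertex with this same property; (iii) $T$ is a star or $T$ is the path $P_6$.
   Context: A leaf is a vertex of degree 1. A star is a tree in which one vertex is adjacent to all others; $P_6$ is the path on 6 vertices. -}

module Defs where

open import Data.Nat using (ℕ; zero; suc; _+_; _≥_; _≡ᵇ_)
open import Data.Fin using (Fin; toℕ; _≟_)
open import Data.Bool using (Bool; true; false; not; _∧_; _∨_; if_then_else_)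
open import Data.List using (List; []; _∷_; _++_; length)
open import Data.List.Relation.Unary.All using (All)
open import Data.List.Relation.Unary.Unique.Propositional using (Unique)
open import Data.List.Relation.Unary.Linked using (Linked)
open import Data.Product using (Σ; ∃; _×_; _,_)
open import Data.Sum using (_⊎_)
open import Data.Empty using (⊥)
open import Relation.Nullary using (¬_; yes; no)
open import Relation.Binary.PropositionalEquality using (_≡_; _≢_)
open import Function.Bundles using (_⇔_)
open import Function.Definitions using (Injective)

record Graph (n : ℕ) : Set where
  field
    adj    : Fin n → Fin n → Bool
    sym    : ∀ a b → adj a b ≡ adj b a
    irrefl : ∀ a → adj a a ≡ false
open Graph public

module _ {n : ℕ} (G : Graph n) where

  Adj : Fin n → Fin n → Set
  Adj a b = adj G a b ≡ true

count : ∀ {n} → (Fin n → Bool) → ℕ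
count {zero}  p = 0
count {suc n} p = (if p Fin.zero then 1 else 0) + count (λ i → p (Fin.suc i))
  where import Data.Fin as Fin

module _ {n : ℕ} (G : Graph n) where

  degree : Fin n → ℕ
  degree v = count (adj G v)

  isLeafᵇ : Fin n → Bool
  isLeafᵇ v = degree v ≡ᵇ 1

  Leaf : Fin n → Set
  Leaf v = degree v ≡ 1

  -- Everything below is about the subgraph of G induced by a vertex subset S.
  module _ (S : Fin n → Bool) where

    In : Fin n → Set
    In v = S v ≡ true

    data Reach : Fin n → Fin n → Set where
      here : ∀ {a} → Reach a a
      step : ∀ {a b c} → Adj G a b → In b → Reach b c → Reach a c

    ConnectedOn : Set
    ConnectedOn = ∀ a b → In a → In b → Reach a b

    CycleOn : Set
    CycleOn = Σ (Fin n) λ x → Σ (List (Fin n)) λ xs →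
      (length (x ∷ xs) ≥ 3) × Unique (x ∷ xs) × All In (x ∷ xs) ×
      Linked (Adj G) ((x ∷ xs) ++ (x ∷ []))

    AcyclicOn : Set
    AcyclicOn = ¬ CycleOn

    IsTreeOn : Set
    IsTreeOn = ConnectedOn × AcyclicOn

    sizeOn : ℕ
    sizeOn = count S

    IsStarOn : Set
    IsStarOn = Σ (Fin n) λ c → In c × (∀ w → In w → w ≢ c → Adj G c w)

  all : Fin n → Bool
  all _ = true

  IsTree : Set
  IsTree = IsTreeOn all

  IsStar : Set
  IsStar = IsStarOn all

IsP6 : ∀ {n} → Graph n → Set
IsP6 {n} G = (n ≡ 6) × Σ (Fin 6 → Fin n) λ f → Injective _≡_ _≡_ f ×
  (∀ i j → Adj G (f i) (f j) ⇔ (suc (toℕ i) ≡ toℕ j ⊎ suc (toℕ j) ≡ toℕ i))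

module _ {n : ℕ} (G : Graph n) where

  deleteVLeaves : Fin n → Fin n → Bool
  deleteVLeaves v w with w ≟ v
  ... | yes _ = false
  ... | no _  = not (adj G v w ∧ isLeafᵇ G w)

  Cond1 : Set
  Cond1 = Σ (Fin n) λ v → ¬ Leaf G v ×
    (Σ (Fin n) λ u → Adj G v u × ¬ Leaf G u ×
       (∀ w → Adj G v w → ¬ Leaf G w → w ≡ u)) ×
    IsTreeOn G (deleteVLeaves v) ×
    (sizeOn G (deleteVLeaves v) ≥ 6 ⊎
     (sizeOn G (deleteVLeaves v) ≡ 5 × ¬ IsStarOn G (deleteVLeaves v)))

  Touches : Fin n → Fin n → Fin n → Fin n → Set
  Touches x y a b = x ≡ a ⊎ x ≡ b ⊎ y ≡ a ⊎ y ≡ b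

  SameEdge : Fin n → Fin n → Fin n → Fin n → Set
  SameEdge x y a b = (x ≡ a × y ≡ b) ⊎ (x ≡ b × y ≡ a)

  Dominating : Fin n → Fin n → Fin n → Fin n → Set
  Dominating a b c d = ∀ x y → Adj G x y →
    ¬ SameEdge x y a b → ¬ SameEdge x y c d →
    Touches x y a b ⊎ Touches x y c d

  Cond2 : Set
  Cond2 =
    (Σ (Fin n) λ a → Σ (Fin n) λ b → Σ (Fin n) λ c → Σ (Fin n) λ d →
      Adj G a b × Adj G c d ×
      a ≢ c × a ≢ d × b ≢ c × b ≢ d × Dominating a b c d)
    ×
    (Σ (Fin n) λ a → Σ (Fin n) λ b → Σ (Fin n) λ c →
      Adj G a b × Adj G b c × a ≢ c × Dominating a b b c)

-- Call the non-leaves of T inner; they span a subtree. If some inner vertex has no inner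
-- neighbour it is the only one and T is a star. Otherwise the two ends v, w of a maximal
-- path of inner vertices are inner leaves: each has exactly one inner neighbour (u, resp. u′)
-- and at least one leaf. If v, u, w are all the inner vertices, every edge meets the spine
-- v u w (or v u when u = w), which yields the edge pairs of (ii). Otherwise some fourth inner
-- vertex r exists, u ≠ w, and we delete the end with fewer leaves, say v, with its leaves.
-- What remains is a tree S containing u, r, w and a leaf lw of w. If |S| ≥ 6 this is (i);
-- if |S| = 5 then S is no star, as a centre would have to be lw or w; and if |S| ≤ 4 then
-- S = {u, r, w, lw}, so v and w have one leaf each and T is the path P₆ = lv v u r w lw.

module Submission where

open import Defs
open import Data.Bool using (Bool; true; false; not; _∧_; if_then_else_)
import Data.Bool as Bool
open import Data.Bool.Properties using (∧-identityʳ; ∧-zeroʳ)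
open import Data.Empty using (⊥-elim)
open import Data.Fin using (Fin; toℕ; _≟_)
import Data.Fin as Fin
open import Data.Fin.Properties using (any?)
open import Data.List using (List; []; _∷_; _++_; length; lookup)
open import Data.List.Membership.Propositional using (_∈_; _∉_)
open import Data.List.Membership.Propositional.Properties using (∈-lookup)
open import Data.List.Relation.Binary.Subset.Propositional using (_⊆_)
open import Data.List.Relation.Unary.All using (All; []; _∷_)
import Data.List.Relation.Unary.All as All
open import Data.List.Relation.Unary.All.Properties using (¬Any⇒All¬)
open import Data.List.Relation.Unary.AllPairs using ([]; _∷_)
open import Data.List.Relation.Unary.Any using (here; there) renaming (any? to any∈?)
open import Data.List.Relation.Unary.Any.Properties using (¬Any[])
open import Data.List.Relation.Unary.Linked using (Linked; []; [-]; _∷_)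
import Data.List.Relation.Unary.Linked as Linked
open import Data.List.Relation.Unary.Unique.Propositional using (Unique)
open import Data.Nat using (ℕ; zero; suc; _+_; _≤_; _<_; _≥_; _≤?_; z≤n; s≤s)
import Data.Nat as ℕ
open import Data.Nat.Properties
  using (suc-injective; ≡ᵇ⇒≡; ≤-reflexive; ≤-trans; ≤-antisym; ≤-total; ≤∧≢⇒<; <⇒≱; ≰⇒>; 1+n≰n; n≤1+n;
         +-suc; +-identityʳ; +-mono-≤)
open import Data.Product using (∃; ∃₂; _×_; _,_; proj₁; proj₂; uncurry)
open import Data.Sum using (_⊎_; inj₁; inj₂; [_,_]′)
import Data.Sum as Sum
open import Function using (_∘_)
open import Function.Bundles using (_⇔_; mk⇔)
open import Relation.Nullary using (¬_; Dec; yes; no; does; _×-dec_; ¬?)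
open import Relation.Nullary.Decidable using (dec-false)
import Relation.Binary.PropositionalEquality as ≡
open ≡ using (_≡_; _≢_; refl; cong; subst)

-- Counting

false≢true : false ≢ true
false≢true ()

count-none : ∀ {n} {p : Fin n → Bool} → (∀ i → p i ≢ true) → count p ≡ 0
count-none {zero}          none = refl
count-none {suc n} {p} none with p Fin.zero in p0
... | true  = ⊥-elim (none Fin.zero p0)
... | false = count-none (none ∘ Fin.suc)

count-true : ∀ {n} → count {n} (λ _ → true) ≡ n
count-true {zero}  = refl
count-true {suc n} = cong suc (count-true {n})

count-split : ∀ {n} (p q : Fin n → Bool) →
  count p ≡ count (λ i → p i ∧ q i) + count (λ i → p i ∧ not (q i))
count-split {zero}  p q = refl
count-split {suc n} p q with p Fin.zero | q Fin.zero | count-split (p ∘ Fin.suc) (q ∘ Fin.suc)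
... | true  | true  | ih = cong suc ih
... | true  | false | ih = ≡.trans (cong suc ih) (≡.sym (+-suc _ _))
... | false | _     | ih = ih

count-at : ∀ {n} (p : Fin n → Bool) x →
  count (λ i → p i ∧ does (i ≟ x)) ≡ (if p x then 1 else 0)
count-at {suc n} p Fin.zero
  rewrite ∧-identityʳ (p Fin.zero)
        | count-none {p = λ i → p (Fin.suc i) ∧ false} (λ i → subst (_≢ true) (≡.sym (∧-zeroʳ _)) λ ())
  = +-identityʳ _
count-at {suc n} p (Fin.suc x) rewrite ∧-zeroʳ (p Fin.zero) = count-at (p ∘ Fin.suc) x

_∖_ : ∀ {n} → (Fin n → Bool) → Fin n → Fin n → Bool
(p ∖ x) i = p i ∧ not (does (i ≟ x))

∖-intro : ∀ {n} {p : Fin n → Bool} {x y} → p y ≡ true → y ≢ x → (p ∖ x) y ≡ true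
∖-intro {x = x} {y} py y≢x rewrite py | dec-false (y ≟ x) y≢x = refl

∖-elim : ∀ {n} {p : Fin n → Bool} {x y} → (p ∖ x) y ≡ true → p y ≡ true × y ≢ x
∖-elim {p = p} {x} {y} e with p y | y ≟ x
∖-elim _  | true  | no y≢x = refl , y≢x
∖-elim () | true  | yes _
∖-elim () | false | _

count-∖ : ∀ {n} (p : Fin n → Bool) x → count p ≡ (if p x then 1 else 0) + count (p ∖ x)
count-∖ p x = ≡.trans (count-split p (λ i → does (i ≟ x))) (cong (_+ count (p ∖ x)) (count-at p x))

Unique⇒length≤count : ∀ {n} {p : Fin n → Bool} {xs} →
  Unique xs → All (λ x → p x ≡ true) xs → length xs ≤ count p
Unique⇒length≤count {xs = []} _ _ = z≤n
Unique⇒length≤count {p = p} {x ∷ xs} (x∉xs ∷ unique) (px ∷ pxs) rewrite count-∖ p x | px =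
  s≤s (Unique⇒length≤count {p = p ∖ x} unique
        (All.zipWith (λ (x≢y , py) → ∖-intro {p = p} py (x≢y ∘ ≡.sym)) (x∉xs , pxs)))

count≤length : ∀ {n} {p : Fin n → Bool} xs → (∀ i → p i ≡ true → i ∈ xs) → count p ≤ length xs
count≤length [] covered = ≤-reflexive (count-none λ i pi → ¬Any[] (covered i pi))
count≤length {p = p} (x ∷ xs) covered rewrite count-∖ p x =
  +-mono-≤ (indicator≤1 (p x)) (count≤length {p = p ∖ x} xs covered∖x)
  where
  indicator≤1 : ∀ b → (if b then 1 else 0) ≤ 1
  indicator≤1 true  = s≤s z≤n
  indicator≤1 false = z≤n
  covered∖x : ∀ i → (p ∖ x) i ≡ true → i ∈ xs
  covered∖x i e with ∖-elim {p = p} e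
  ... | pi , i≢x with covered i pi
  ...   | here i≡x = ⊥-elim (i≢x i≡x)
  ...   | there i∈xs = i∈xs

count≤1⇒unique : ∀ {n} {p : Fin n → Bool} → count p ≤ 1 → ∀ {a b} → p a ≡ true → p b ≡ true → a ≡ b
count≤1⇒unique c≤1 {a} {b} pa pb with a ≟ b
... | yes a≡b = a≡b
... | no a≢b with ≤-trans (Unique⇒length≤count ((a≢b ∷ []) ∷ [] ∷ []) (pa ∷ pb ∷ [])) c≤1
...   | s≤s ()

∃-of-count≥1 : ∀ {n} {p : Fin n → Bool} → 1 ≤ count p → ∃ λ y → p y ≡ true
∃-of-count≥1 {p = p} c≥1 with any? (λ y → p y Bool.≟ true)
... | yes found = found
... | no none with ≤-trans c≥1 (count≤length [] λ i pi → ⊥-elim (none (i , pi)))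
...   | ()

∃-of-count≥2 : ∀ {n} {p : Fin n → Bool} → 2 ≤ count p → ∀ z → ∃ λ y → p y ≡ true × y ≢ z
∃-of-count≥2 {p = p} c≥2 z with any? (λ y → (p y Bool.≟ true) ×-dec ¬? (y ≟ z))
... | yes found = found
... | no none with ≤-trans c≥2 (count≤length (z ∷ []) only-z)
  where
  only-z : ∀ i → p i ≡ true → i ∈ z ∷ []
  only-z i pi with i ≟ z
  ... | yes i≡z = here i≡z
  ... | no i≢z  = ⊥-elim (none (i , pi , i≢z))
...   | s≤s ()

count≤length⇒∈ : ∀ {n} {p : Fin n → Bool} {xs} → Unique xs → All (λ x → p x ≡ true) xs →
  count p ≤ length xs → ∀ {y} → p y ≡ true → y ∈ xs
count≤length⇒∈ {xs = xs} unique pxs c≤ {y} py with any∈? (y ≟_) xs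
... | yes y∈xs = y∈xs
... | no y∉xs = ⊥-elim (1+n≰n (≤-trans (Unique⇒length≤count (¬Any⇒All¬ xs y∉xs ∷ unique) (py ∷ pxs)) c≤))

Unique⇒length≤n : ∀ {n} {xs : List (Fin n)} → Unique xs → length xs ≤ n
Unique⇒length≤n {n} {xs} unique =
  subst (length xs ≤_) (count-true {n}) (Unique⇒length≤count {p = λ _ → true} unique (All.universal (λ _ → refl) xs))

covers⇒n≤length : ∀ {n} (xs : List (Fin n)) → (∀ x → x ∈ xs) → n ≤ length xs
covers⇒n≤length {n} xs covers = subst (_≤ length xs) (count-true {n}) (count≤length {p = λ _ → true} xs λ x _ → covers x)

-- Lists

module _ {a} {A : Set a} where

  takeThrough : ∀ {z} (xs : List A) → z ∈ xs → List A
  takeThrough (x ∷ xs) (here _)  = x ∷ []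
  takeThrough (x ∷ xs) (there p) = x ∷ takeThrough xs p

  takeThrough-nonempty : ∀ {z xs} (p : z ∈ xs) → 1 ≤ length (takeThrough xs p)
  takeThrough-nonempty (here _)  = s≤s z≤n
  takeThrough-nonempty (there _) = s≤s z≤n

  All-takeThrough : ∀ {ℓ} {P : A → Set ℓ} {z xs} → All P xs → (p : z ∈ xs) → All P (takeThrough xs p)
  All-takeThrough (px ∷ _)   (here _)  = px ∷ []
  All-takeThrough (px ∷ pxs) (there p) = px ∷ All-takeThrough pxs p

  Unique-takeThrough : ∀ {z xs} → Unique xs → (p : z ∈ xs) → Unique (takeThrough xs p)
  Unique-takeThrough (_ ∷ _)       (here _)  = [] ∷ []
  Unique-takeThrough (x∉ ∷ unique) (there p) = All-takeThrough x∉ p ∷ Unique-takeThrough unique p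

module _ {a r} {A : Set a} {R : A → A → Set r} where

  Linked-takeThrough : ∀ {a b z xs} → Linked R (a ∷ xs) → (p : z ∈ xs) → R z b →
    Linked R (a ∷ takeThrough xs p ++ b ∷ [])
  Linked-takeThrough (r ∷ _)  (here refl) rzb = r ∷ rzb ∷ [-]
  Linked-takeThrough (r ∷ rs) (there p)   rzb = r ∷ Linked-takeThrough rs p rzb

  Linked-lookup : ∀ {xs} → Linked R xs → ∀ i j → suc (toℕ i) ≡ toℕ j → R (lookup xs i) (lookup xs j)
  Linked-lookup (r ∷ _)  Fin.zero    (Fin.suc Fin.zero) refl = r
  Linked-lookup (_ ∷ rs) (Fin.suc i) (Fin.suc j)        e    = Linked-lookup rs i j (suc-injective e)
  Linked-lookup [-]      Fin.zero    Fin.zero           ()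
  Linked-lookup (_ ∷ _)  Fin.zero    Fin.zero           ()
  Linked-lookup (_ ∷ _)  Fin.zero    (Fin.suc (Fin.suc _)) ()
  Linked-lookup (_ ∷ _)  (Fin.suc _) Fin.zero           ()

Unique-lookup-injective : ∀ {a} {A : Set a} {xs : List A} → Unique xs →
  ∀ {i j} → lookup xs i ≡ lookup xs j → i ≡ j
Unique-lookup-injective (_ ∷ _) {Fin.zero} {Fin.zero} _ = refl
Unique-lookup-injective (x∉ ∷ _) {Fin.zero} {Fin.suc j} e = ⊥-elim (All.lookup x∉ (∈-lookup j) e)
Unique-lookup-injective (x∉ ∷ _) {Fin.suc i} {Fin.zero} e = ⊥-elim (All.lookup x∉ (∈-lookup i) (≡.sym e))
Unique-lookup-injective (_ ∷ unique) {Fin.suc i} {Fin.suc j} e = cong Fin.suc (Unique-lookup-injective unique e)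

-- Graphs and trees

module _ {n} (G : Graph n) where

  Adj-sym : ∀ {a b} → Adj G a b → Adj G b a
  Adj-sym {a} {b} ab = ≡.trans (Graph.sym G b a) ab

  Adj-irrefl : ∀ {a} → ¬ Adj G a a
  Adj-irrefl {a} aa = false≢true (≡.trans (≡.sym (Graph.irrefl G a)) aa)

  Adj⇒≢ : ∀ {a b} → Adj G a b → a ≢ b
  Adj⇒≢ ab refl = Adj-irrefl ab

  leaf? : ∀ x → Dec (Leaf G x)
  leaf? x = degree G x ℕ.≟ 1

  Leaf⇒isLeafᵇ : ∀ {x} → Leaf G x → isLeafᵇ G x ≡ true
  Leaf⇒isLeafᵇ lx rewrite lx = refl

  isLeafᵇ⇒Leaf : ∀ {x} → isLeafᵇ G x ≡ true → Leaf G x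
  isLeafᵇ⇒Leaf {x} e = ≡ᵇ⇒≡ (degree G x) 1 (subst Bool.T (≡.sym e) _)

  leaf-neighbour-unique : ∀ {x a b} → Leaf G x → Adj G x a → Adj G x b → a ≡ b
  leaf-neighbour-unique lx = count≤1⇒unique (≤-reflexive lx)

  leavesAt : Fin n → Fin n → Bool
  leavesAt v x = adj G v x ∧ isLeafᵇ G x

  leavesAt-intro : ∀ {v x} → Adj G v x → Leaf G x → leavesAt v x ≡ true
  leavesAt-intro vx lx rewrite vx | Leaf⇒isLeafᵇ lx = refl

  leavesAt-elim : ∀ {v x} → leavesAt v x ≡ true → Adj G v x × Leaf G x
  leavesAt-elim {v} {x} e with adj G v x | isLeafᵇ G x in lx
  leavesAt-elim _  | true  | true  = refl , isLeafᵇ⇒Leaf lx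
  leavesAt-elim () | true  | false
  leavesAt-elim () | false | _

  deleteVLeaves≡true : ∀ {v y} → y ≢ v → ¬ (Adj G v y × Leaf G y) → deleteVLeaves G v y ≡ true
  deleteVLeaves≡true {v} {y} y≢v ¬pendant with y ≟ v
  ... | yes y≡v = ⊥-elim (y≢v y≡v)
  ... | no _ with leavesAt v y in e
  ...   | true  = ⊥-elim (¬pendant (leavesAt-elim e))
  ...   | false = refl

  deleteVLeaves≡true⇒ : ∀ {v y} → deleteVLeaves G v y ≡ true → y ≢ v × ¬ (Adj G v y × Leaf G y)
  deleteVLeaves≡true⇒ {v} {y} e with y ≟ v
  ... | yes _ = ⊥-elim (false≢true e)
  ... | no y≢v with leavesAt v y in e′
  ...   | true  = ⊥-elim (false≢true e)
  ...   | false = y≢v , λ (vy , ly) → false≢true (≡.trans (≡.sym e′) (leavesAt-intro vy ly))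

  deleteVLeaves≡false⇒ : ∀ {v y} → deleteVLeaves G v y ≡ false → y ≡ v ⊎ (Adj G v y × Leaf G y)
  deleteVLeaves≡false⇒ {v} {y} e with y ≟ v
  ... | yes y≡v = inj₁ y≡v
  ... | no _ with leavesAt v y in e′
  ...   | true  = inj₂ (leavesAt-elim e′)
  ...   | false = ⊥-elim (false≢true (≡.sym e))

Reach⇒neighbour : ∀ {n} {G : Graph n} {S a b} → Reach G S a b → b ≢ a → ∃ (Adj G a)
Reach⇒neighbour here          b≢a = ⊥-elim (b≢a refl)
Reach⇒neighbour (step ab _ _) _   = _ , ab

module Tree {n} {T : Graph n} (connected : ConnectedOn T (all T)) (acyclic : AcyclicOn T (all T)) where

  Inner : Fin n → Set
  Inner x = ¬ Leaf T x

  inner≢leaf : ∀ {x y} → Inner x → Leaf T y → x ≢ y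
  inner≢leaf ix ly refl = ix ly

  Pendant : (Fin n → Set) → Fin n → Fin n → Set
  Pendant P v u = P v × Adj T v u × P u × (∀ w → Adj T v w → P w → w ≡ u)

  InnerLeaf : Fin n → Fin n → Set
  InnerLeaf = Pendant Inner

  closed⇒universal : (C : Fin n → Set) → (∀ {a b} → C a → Adj T a b → C b) →
    ∀ {x} → C x → ∀ y → C y
  closed⇒universal C closed {x} cx y = along (connected x y refl refl) cx
    where
    along : ∀ {a b} → Reach T (all T) a b → C a → C b
    along here          ca = ca
    along (step ab _ r) ca = along r (closed ca ab)

  neighbour : 2 ≤ n → ∀ a → ∃ (Adj T a)
  neighbour 2≤n a with ∃-of-count≥2 {p = λ _ → true} (subst (2 ≤_) (≡.sym (count-true {n})) 2≤n) a
  ... | b , _ , b≢a = Reach⇒neighbour (connected a b refl refl) b≢a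

  Inner⇒degree≥2 : 2 ≤ n → ∀ {x} → Inner x → 2 ≤ degree T x
  Inner⇒degree≥2 2≤n {x} ix with neighbour 2≤n x
  ... | _ , xy = ≤∧≢⇒< (Unique⇒length≤count {p = adj T x} ([] ∷ []) (xy ∷ [])) (ix ∘ ≡.sym)

  leaf-edge⇒n≤2 : ∀ {x y} → Leaf T x → Leaf T y → Adj T x y → n ≤ 2
  leaf-edge⇒n≤2 {x} {y} lx ly xy =
    covers⇒n≤length (x ∷ y ∷ []) (closed⇒universal C closed (here refl))
    where
    C : Fin n → Set
    C z = z ∈ x ∷ y ∷ []
    closed : ∀ {a b} → C a → Adj T a b → C b
    closed (here refl)         ab = there (here (leaf-neighbour-unique T lx ab xy))
    closed (there (here refl)) ab = here (leaf-neighbour-unique T ly ab (Adj-sym T xy))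

  edge⇒inner : 3 ≤ n → ∀ {x y} → Adj T x y → Inner x ⊎ Inner y
  edge⇒inner 3≤n {x} {y} xy with leaf? T x | leaf? T y
  ... | no ix  | _      = inj₁ ix
  ... | yes _  | no iy  = inj₂ iy
  ... | yes lx | yes ly with ≤-trans 3≤n (leaf-edge⇒n≤2 lx ly xy)
  ...   | s≤s (s≤s ())

  ∃-inner : 3 ≤ n → ∃ Inner
  ∃-inner 3≤n with ∃-of-count≥1 {p = λ _ → true} (subst (1 ≤_) (≡.sym (count-true {n})) (≤-trans (s≤s z≤n) 3≤n))
  ... | x , _ with neighbour (≤-trans (s≤s (s≤s z≤n)) 3≤n) x
  ...   | y , xy = [ (λ ix → x , ix) , (λ iy → y , iy) ]′ (edge⇒inner 3≤n xy)

  -- A path through a leaf can only return to the leaf's one neighbour, so the inner vertices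
  -- span a connected subgraph.
  inner-closed⇒universal : (K : Fin n → Set) → (∀ {a b} → K a → Inner a → Adj T a b → Inner b → K b) →
    ∀ {x} → K x → Inner x → ∀ z → Inner z → K z
  inner-closed⇒universal K closed {x} kx ix z = proj₁ (closed⇒universal C extend ((λ _ → kx) , (λ lx → ⊥-elim (ix lx))) z)
    where
    C : Fin n → Set
    C z = (Inner z → K z) × (Leaf T z → ∃ λ a → Inner a × K a × Adj T a z)
    extend : ∀ {a b} → C a → Adj T a b → C b
    extend {a} (ka , la) ab with leaf? T a
    ... | no ia = (closed (ka ia) ia ab) , λ _ → a , ia , ka ia , ab
    ... | yes l with la l
    ...   | c , ic , kc , ca with leaf-neighbour-unique T l (Adj-sym T ca) ab
    ...     | refl = (λ _ → kc) , λ lc → ⊥-elim (ic lc)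

  lone-inner⇒star : 3 ≤ n → ∀ {p} → (∀ z → Inner z → z ≡ p) → IsStar T
  lone-inner⇒star 3≤n {p} lone = p , refl , λ w _ → p-adj w
    where
    p-adj : ∀ w → w ≢ p → Adj T p w
    p-adj w w≢p with leaf? T w
    ... | no iw = ⊥-elim (w≢p (lone w iw))
    ... | yes lw with neighbour (≤-trans (s≤s (s≤s z≤n)) 3≤n) w
    ...   | y , wy with edge⇒inner 3≤n wy
    ...     | inj₁ iw = ⊥-elim (iw lw)
    ...     | inj₂ iy with lone y iy
    ...       | refl = Adj-sym T wy

  no-chord : ∀ {x y z ys} → Unique (x ∷ y ∷ ys) → Linked (Adj T) (x ∷ y ∷ ys) → z ∈ ys → ¬ Adj T x z
  no-chord {x} {y} {ys = ys} unique linked z∈ys xz =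
    acyclic (x , takeThrough (y ∷ ys) (there z∈ys) , s≤s (s≤s (takeThrough-nonempty z∈ys)) ,
             Unique-takeThrough unique (there (there z∈ys)) , All.universal (λ _ → refl) _ ,
             Linked-takeThrough linked (there z∈ys) (Adj-sym T xz))

  adjacent-to-start : ∀ {x xs} → Unique (x ∷ xs) → Linked (Adj T) (x ∷ xs) → ∀ j →
    Adj T x (lookup xs j) → toℕ j ≡ 0
  adjacent-to-start {xs = _ ∷ _} _      _      Fin.zero    _  = refl
  adjacent-to-start {xs = _ ∷ _} unique linked (Fin.suc k) xz = ⊥-elim (no-chord unique linked (∈-lookup k) xz)

  adjacent-in-path : ∀ {xs} → Unique xs → Linked (Adj T) xs → ∀ i j →
    Adj T (lookup xs i) (lookup xs j) → suc (toℕ i) ≡ toℕ j ⊎ suc (toℕ j) ≡ toℕ i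
  adjacent-in-path {_ ∷ _} _ _ Fin.zero Fin.zero a = ⊥-elim (Adj-irrefl T a)
  adjacent-in-path {_ ∷ _} unique linked Fin.zero (Fin.suc j) a =
    inj₁ (cong suc (≡.sym (adjacent-to-start unique linked j a)))
  adjacent-in-path {_ ∷ _} unique linked (Fin.suc i) Fin.zero a =
    inj₂ (cong suc (≡.sym (adjacent-to-start unique linked i (Adj-sym T a))))
  adjacent-in-path {_ ∷ _} (_ ∷ unique) linked (Fin.suc i) (Fin.suc j) a =
    Sum.map (cong suc) (cong suc) (adjacent-in-path unique (Linked.tail linked) i j a)

  path-adjacency : ∀ {xs} → Unique xs → Linked (Adj T) xs → ∀ i j →
    Adj T (lookup xs i) (lookup xs j) ⇔ (suc (toℕ i) ≡ toℕ j ⊎ suc (toℕ j) ≡ toℕ i)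
  path-adjacency unique linked i j =
    mk⇔ (adjacent-in-path unique linked i j)
        [ Linked-lookup linked i j , Adj-sym T ∘ Linked-lookup linked j i ]′

  module MaximalPath {P : Fin n → Set} (P? : ∀ x → Dec (P x)) where

    PPath : List (Fin n) → Set
    PPath xs = Unique xs × Linked (Adj T) xs × All P xs

    Saturated : Fin n → List (Fin n) → Set
    Saturated x xs = ∀ y → Adj T x y → P y → y ∈ x ∷ xs

    extend : ∀ fuel {x xs} → PPath (x ∷ xs) → n < length (x ∷ xs) + fuel →
      ∃₂ λ x′ xs′ → PPath (x′ ∷ xs′) × Saturated x′ xs′ × xs ⊆ xs′
    extend zero (unique , _) n< = ⊥-elim (<⇒≱ (subst (n <_) (+-identityʳ _) n<) (Unique⇒length≤n unique))
    extend (suc fuel) {x} {xs} path@(unique , linked , ps) n<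
      with any? (λ y → (adj T x y Bool.≟ true) ×-dec (P? y ×-dec ¬? (any∈? (y ≟_) (x ∷ xs))))
    ... | no none = x , xs , path , saturated , λ z∈xs → z∈xs
      where
      saturated : Saturated x xs
      saturated y xy py with any∈? (y ≟_) (x ∷ xs)
      ... | yes y∈ = y∈
      ... | no y∉  = ⊥-elim (none (y , xy , py , y∉))
    ... | yes (y , xy , py , y∉) with extend fuel {y} {x ∷ xs}
          ((¬Any⇒All¬ _ y∉ ∷ unique) , (Adj-sym T xy ∷ linked) , (py ∷ ps))
          (subst (n <_) (+-suc _ fuel) n<)
    ...   | x′ , xs′ , path′ , saturated′ , ⊆xs′ = x′ , xs′ , path′ , saturated′ , ⊆xs′ ∘ there

    saturated⇒pendant : ∀ {v x xs} → PPath (v ∷ x ∷ xs) → Saturated v (x ∷ xs) → Pendant P v x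
    saturated⇒pendant {v} {x} (unique , linked@(vx ∷ _) , pv ∷ px ∷ _) saturated = pv , vx , px , only-x
      where
      only-x : ∀ y → Adj T v y → P y → y ≡ x
      only-x y vy py with saturated y vy py
      ... | here refl          = ⊥-elim (Adj-irrefl T vy)
      ... | there (here y≡x)   = y≡x
      ... | there (there y∈xs) = ⊥-elim (no-chord unique linked y∈xs vy)

    far-pendant : ∀ {a b} → P a → P b → Adj T a b → ∃₂ λ v u → Pendant P v u × v ≢ b
    far-pendant {a} {b} pa pb ab
      with extend n {a} {b ∷ []} (((Adj⇒≢ T ab ∷ []) ∷ [] ∷ []) , (ab ∷ [-]) , (pa ∷ pb ∷ []))
                  (s≤s (n≤1+n n))
    ... | _ , [] , _ , _ , ⊆xs′ with () ← ⊆xs′ (here refl)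
    ... | v , _ ∷ _ , path′@(v∉ ∷ _ , _) , saturated , ⊆xs′ =
      v , _ , saturated⇒pendant path′ saturated , All.lookup v∉ (⊆xs′ (here refl))

    two-pendants : ∀ {a b} → P a → P b → Adj T a b →
      ∃₂ λ v u → ∃₂ λ w u′ → Pendant P v u × Pendant P w u′ × w ≢ v
    two-pendants pa pb ab with far-pendant pa pb ab
    ... | v , u , pendant@(pv , vu , pu , _) , _ with far-pendant pu pv (Adj-sym T vu)
    ...   | w , u′ , pendant′ , w≢v = v , u , w , u′ , pendant , pendant′ , w≢v

  acyclicOn : ∀ S → AcyclicOn T S
  acyclicOn S (x , xs , long , unique , _ , linked) =
    acyclic (x , xs , long , unique , All.universal (λ _ → refl) _ , linked)

  module Gated (S : Fin n → Bool) {g} (g∈S : S g ≡ true)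
    (gate : ∀ {x y} → S x ≡ true → S y ≡ false → Adj T x y → x ≡ g) where

    -- A walk ending in S enters S for the last time through g.
    gated-reach : ∀ {a b} → Reach T (all T) a b → S b ≡ true →
      (S a ≡ true → Reach T S a b) × (S a ≡ false → Reach T S g b)
    gated-reach here b∈S = (λ _ → here) , λ b∉S → ⊥-elim (false≢true (≡.trans (≡.sym b∉S) b∈S))
    gated-reach {a} {b} (step {b = c} ac _ r) b∈S with gated-reach r b∈S | S c in c∈S
    ... | from-c , _ | true  = (λ _ → step ac c∈S (from-c c∈S)) ,
                               λ a∉S → subst (λ z → Reach T S z b) (gate c∈S a∉S (Adj-sym T ac)) (from-c c∈S)
    ... | _ , from-g | false = (λ a∈S → subst (λ z → Reach T S z b) (≡.sym (gate a∈S c∈S ac)) (from-g c∈S)) ,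
                               λ _ → from-g c∈S

    gated-connected : ConnectedOn T S
    gated-connected a b a∈S b∈S = proj₁ (gated-reach (connected a b refl refl) b∈S) a∈S

  deleteVLeaves-isTree : ∀ {v u} → InnerLeaf v u → IsTreeOn T (deleteVLeaves T v)
  deleteVLeaves-isTree {v} {u} (_ , vu , iu , only-u) = Gated.gated-connected S u∈S gate , acyclicOn S
    where
    S : Fin n → Bool
    S = deleteVLeaves T v
    u∈S : S u ≡ true
    u∈S = deleteVLeaves≡true T (Adj⇒≢ T vu ∘ ≡.sym) (λ (_ , lu) → iu lu)
    gate : ∀ {x y} → S x ≡ true → S y ≡ false → Adj T x y → x ≡ u
    gate {x} {y} x∈S y∉S xy with deleteVLeaves≡false⇒ T {v} {y} y∉S | deleteVLeaves≡true⇒ T {v} {x} x∈S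
    ... | inj₁ refl      | _ , ¬pendant = only-u x (Adj-sym T xy) (λ lx → ¬pendant (Adj-sym T xy , lx))
    ... | inj₂ (vy , ly) | x≢v , _      = ⊥-elim (x≢v (leaf-neighbour-unique T ly (Adj-sym T xy) (Adj-sym T vy)))

-- The classification

module Classification {n} {T : Graph n} (connected : ConnectedOn T (all T)) (acyclic : AcyclicOn T (all T))
  (6≤n : 6 ≤ n) where

  open Tree connected acyclic public

  Conclusion : Set
  Conclusion = Cond1 T ⊎ Cond2 T ⊎ (IsStar T ⊎ IsP6 T)

  2≤n : 2 ≤ n
  2≤n = ≤-trans (s≤s (s≤s z≤n)) 6≤n

  3≤n : 3 ≤ n
  3≤n = ≤-trans (s≤s (s≤s (s≤s z≤n))) 6≤n

  inner? : ∀ x → Dec (Inner x)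
  inner? x = ¬? (leaf? T x)

  open MaximalPath inner? public using (two-pendants)

  inner-outside : (xs : List (Fin n)) → (∃ λ r → Inner r × r ∉ xs) ⊎ (∀ z → Inner z → z ∈ xs)
  inner-outside xs with any? (λ r → inner? r ×-dec ¬? (any∈? (r ≟_) xs))
  ... | yes found = inj₁ found
  ... | no none = inj₂ covered
    where
    covered : ∀ z → Inner z → z ∈ xs
    covered z iz with any∈? (z ≟_) xs
    ... | yes z∈xs = z∈xs
    ... | no z∉xs  = ⊥-elim (none (z , iz , z∉xs))

  leaf-at : ∀ {v u} → InnerLeaf v u → ∃ λ l → Adj T v l × Leaf T l
  leaf-at {v} {u} (iv , _ , _ , only-u) with ∃-of-count≥2 (Inner⇒degree≥2 2≤n iv) u
  ... | l , vl , l≢u with leaf? T l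
  ...   | yes ll = l , vl , ll
  ...   | no il  = ⊥-elim (l≢u (only-u l vl il))

  dominating : ∀ {a b c d} → (∀ z → Inner z → z ∈ a ∷ b ∷ c ∷ d ∷ []) → Dominating T a b c d
  dominating covered x y xy _ _ with edge⇒inner 3≤n xy
  ... | inj₁ ix = touching-x (covered x ix)
    where
    touching-x : ∀ {a b c d} → x ∈ a ∷ b ∷ c ∷ d ∷ [] → Touches T x y a b ⊎ Touches T x y c d
    touching-x (here e)                         = inj₁ (inj₁ e)
    touching-x (there (here e))                 = inj₁ (inj₂ (inj₁ e))
    touching-x (there (there (here e)))         = inj₂ (inj₁ e)
    touching-x (there (there (there (here e)))) = inj₂ (inj₂ (inj₁ e))
  ... | inj₂ iy = touching-y (covered y iy)
    where
    touching-y : ∀ {a b c d} → y ∈ a ∷ b ∷ c ∷ d ∷ [] → Touches T x y a b ⊎ Touches T x y c d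
    touching-y (here e)                         = inj₁ (inj₂ (inj₂ (inj₁ e)))
    touching-y (there (here e))                 = inj₁ (inj₂ (inj₂ (inj₂ e)))
    touching-y (there (there (here e)))         = inj₂ (inj₂ (inj₂ (inj₁ e)))
    touching-y (there (there (there (here e)))) = inj₂ (inj₂ (inj₂ (inj₂ e)))

  spine⇒Cond2 : ∀ {a b c d} → Adj T a b → Adj T b c → a ≢ c → Adj T c d → d ≢ a → d ≢ b →
    (∀ z → Inner z → z ∈ a ∷ b ∷ c ∷ []) → Cond2 T
  spine⇒Cond2 {a} {b} {c} {d} ab bc a≢c cd d≢a d≢b covered =
    (a , b , c , d , ab , cd , a≢c , d≢a ∘ ≡.sym , Adj⇒≢ T bc , d≢b ∘ ≡.sym ,
     dominating (λ z iz → ⊆abcd (covered z iz))) ,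
    (a , b , c , ab , bc , a≢c , dominating (λ z iz → ⊆abbc (covered z iz)))
    where
    ⊆abcd : a ∷ b ∷ c ∷ [] ⊆ a ∷ b ∷ c ∷ d ∷ []
    ⊆abcd (here e)                 = here e
    ⊆abcd (there (here e))         = there (here e)
    ⊆abcd (there (there (here e))) = there (there (here e))
    ⊆abbc : a ∷ b ∷ c ∷ [] ⊆ a ∷ b ∷ b ∷ c ∷ []
    ⊆abbc (here e)                 = here e
    ⊆abbc (there (here e))         = there (here e)
    ⊆abbc (there (there (here e))) = there (there (there (here e)))

  pendants-apart : ∀ {v u w u′} → InnerLeaf v u → InnerLeaf w u′ → u ≢ w → u′ ≢ v
  pendants-apart (_ , _ , _ , only-u) (iw , wu′ , _ , _) u≢w refl = u≢w (≡.sym (only-u _ (Adj-sym T wu′) iw))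

  double-star⇒Cond2 : ∀ {v u u′} → InnerLeaf v u → InnerLeaf u u′ →
    (∀ z → Inner z → z ∈ v ∷ u ∷ []) → Cond2 T
  double-star⇒Cond2 {v} {u} v-leaf@(iv , vu , iu , _) u-leaf covered
    with leaf-at v-leaf | leaf-at u-leaf
  ... | lv , v-lv , lv-leaf | lu , u-lu , lu-leaf =
    spine⇒Cond2 (Adj-sym T v-lv) vu (inner≢leaf iu lv-leaf ∘ ≡.sym) u-lu lu≢lv
      (inner≢leaf iv lu-leaf ∘ ≡.sym) (λ z iz → there (covered z iz))
    where
    lu≢lv : lu ≢ lv
    lu≢lv refl = Adj⇒≢ T vu (leaf-neighbour-unique T lv-leaf (Adj-sym T v-lv) (Adj-sym T u-lu))

  inner-path⇒Cond2 : ∀ {v u w u′} → InnerLeaf v u → InnerLeaf w u′ → w ≢ v → u ≢ w →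
    (∀ z → Inner z → z ∈ v ∷ u ∷ w ∷ []) → Cond2 T
  inner-path⇒Cond2 {u = u} {w} v-leaf@(iv , vu , iu , _) w-leaf@(iw , wu′ , iu′ , _) w≢v u≢w covered
    with leaf-at w-leaf
  ... | lw , w-lw , lw-leaf =
    spine⇒Cond2 vu uw (w≢v ∘ ≡.sym) w-lw (inner≢leaf iv lw-leaf ∘ ≡.sym) (inner≢leaf iu lw-leaf ∘ ≡.sym) covered
    where
    uw : Adj T u w
    uw with covered _ iu′
    ... | here refl                 = ⊥-elim (pendants-apart v-leaf w-leaf u≢w refl)
    ... | there (here refl)         = Adj-sym T wu′
    ... | there (there (here refl)) = ⊥-elim (Adj-irrefl T wu′)

  few-inner⇒Cond2 : ∀ {v u w u′} → InnerLeaf v u → InnerLeaf w u′ → w ≢ v →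
    (∀ z → Inner z → z ∈ v ∷ u ∷ w ∷ []) → Cond2 T
  few-inner⇒Cond2 {u = u} {w} v-leaf w-leaf w≢v covered with u ≟ w
  ... | yes refl = double-star⇒Cond2 v-leaf w-leaf (λ z iz → merge (covered z iz))
    where
    merge : ∀ {z} → z ∈ _ ∷ u ∷ u ∷ [] → z ∈ _ ∷ u ∷ []
    merge (here e)                 = here e
    merge (there (here e))         = there (here e)
    merge (there (there (here e))) = there (here e)
  ... | no u≢w = inner-path⇒Cond2 v-leaf w-leaf w≢v u≢w covered

  pendant-pair⇒two-inner : ∀ {v u u′} → InnerLeaf v u → InnerLeaf u u′ → ∀ z → Inner z → z ≡ v ⊎ z ≡ u
  pendant-pair⇒two-inner {v} {u} (iv , vu , iu , only-u) (_ , _ , _ , only-u′) =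
    inner-closed⇒universal (λ z → z ≡ v ⊎ z ≡ u) closed (inj₁ refl) iv
    where
    closed : ∀ {a b} → a ≡ v ⊎ a ≡ u → Inner a → Adj T a b → Inner b → b ≡ v ⊎ b ≡ u
    closed (inj₁ refl) _ ab ib = inj₂ (only-u _ ab ib)
    closed (inj₂ refl) _ ab ib = inj₁ (≡.trans (only-u′ _ ab ib) (≡.sym (only-u′ v (Adj-sym T vu) iv)))

  record Ends (v w : Fin n) : Set where
    field
      u u′ r  : Fin n
      v-leaf  : InnerLeaf v u
      w-leaf  : InnerLeaf w u′
      v≢w     : v ≢ w
      u≢w     : u ≢ w
      r-inner : Inner r
      r≢v     : r ≢ v
      r≢u     : r ≢ u
      r≢w     : r ≢ w

  Ends-swap : ∀ {v w} → Ends v w → Ends w v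
  Ends-swap {v} {w} ends = swapped fourth
    where
    open Ends ends
    fourth : ∃ λ r′ → Inner r′ × r′ ≢ w × r′ ≢ u′ × r′ ≢ v
    fourth with r ≟ u′ | v-leaf
    ... | yes refl | _ , vu , iu , _ = u , iu , u≢w , r≢u ∘ ≡.sym , Adj⇒≢ T vu ∘ ≡.sym
    ... | no r≢u′  | _               = r , r-inner , r≢w , r≢u′ , r≢v
    swapped : (∃ λ r′ → Inner r′ × r′ ≢ w × r′ ≢ u′ × r′ ≢ v) → Ends w v
    swapped (r′ , ir′ , r′≢w , r′≢u′ , r′≢v) = record
      { u = u′ ; u′ = u ; r = r′ ; v-leaf = w-leaf ; w-leaf = v-leaf
      ; v≢w = v≢w ∘ ≡.sym ; u≢w = pendants-apart v-leaf w-leaf u≢w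
      ; r-inner = ir′ ; r≢v = r′≢w ; r≢u = r′≢u′ ; r≢w = r′≢v }

  module Deletion {v w lv lw} (ends : Ends v w) (v-lv : Adj T v lv) (lv-leaf : Leaf T lv)
    (w-lw : Adj T w lw) (lw-leaf : Leaf T lw) (fewer : count (leavesAt T v) ≤ count (leavesAt T w)) where

    open Ends ends

    S : Fin n → Bool
    S = deleteVLeaves T v

    iv : Inner v
    iv = proj₁ v-leaf
    vu : Adj T v u
    vu = proj₁ (proj₂ v-leaf)
    iu : Inner u
    iu = proj₁ (proj₂ (proj₂ v-leaf))
    only-u : ∀ x → Adj T v x → Inner x → x ≡ u
    only-u = proj₂ (proj₂ (proj₂ v-leaf))
    iw : Inner w
    iw = proj₁ w-leaf
    only-u′ : ∀ x → Adj T w x → Inner x → x ≡ u′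
    only-u′ = proj₂ (proj₂ (proj₂ w-leaf))

    inner∈S : ∀ {x} → Inner x → x ≢ v → S x ≡ true
    inner∈S ix x≢v = deleteVLeaves≡true T x≢v (λ (_ , lx) → ix lx)

    w-leaf∈S : ∀ {x} → Adj T w x → Leaf T x → S x ≡ true
    w-leaf∈S wx lx = deleteVLeaves≡true T (inner≢leaf iv lx ∘ ≡.sym)
      (λ (vx , _) → v≢w (leaf-neighbour-unique T lx (Adj-sym T vx) (Adj-sym T wx)))

    u∈S : S u ≡ true
    u∈S = inner∈S iu (Adj⇒≢ T vu ∘ ≡.sym)
    r∈S : S r ≡ true
    r∈S = inner∈S r-inner r≢v
    w∈S : S w ≡ true
    w∈S = inner∈S iw (v≢w ∘ ≡.sym)
    lw∈S : S lw ≡ true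
    lw∈S = w-leaf∈S w-lw lw-leaf

    not-star : ¬ IsStarOn T S
    not-star (c , _ , centre) with c ≟ lw
    ... | yes refl = u≢w (leaf-neighbour-unique T lw-leaf (centre u u∈S (inner≢leaf iu lw-leaf)) (Adj-sym T w-lw))
    ... | no c≢lw with leaf-neighbour-unique T lw-leaf (Adj-sym T (centre lw lw∈S (c≢lw ∘ ≡.sym))) (Adj-sym T w-lw)
    ...   | refl = r≢u (≡.trans (only-u′ r (centre r r∈S r≢w) r-inner) (≡.sym (only-u′ u (centre u u∈S u≢w) iu)))

    cond1 : sizeOn T S ≥ 6 ⊎ (sizeOn T S ≡ 5 × ¬ IsStarOn T S) → Cond1 T
    cond1 size = v , iv , (u , proj₂ v-leaf) , deleteVLeaves-isTree v-leaf , size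

    kept-list : List (Fin n)
    kept-list = u ∷ r ∷ w ∷ lw ∷ []

    kept-unique : Unique kept-list
    kept-unique = ((r≢u ∘ ≡.sym) ∷ u≢w ∷ inner≢leaf iu lw-leaf ∷ []) ∷
                  (r≢w ∷ inner≢leaf r-inner lw-leaf ∷ []) ∷ (Adj⇒≢ T w-lw ∷ []) ∷ [] ∷ []

    module SmallRemainder (S≤4 : count S ≤ 4) where

      S⊆kept-list : ∀ {x} → S x ≡ true → x ∈ kept-list
      S⊆kept-list = count≤length⇒∈ kept-unique (u∈S ∷ r∈S ∷ w∈S ∷ lw∈S ∷ []) S≤4

      only-lw : ∀ {x} → Adj T w x → Leaf T x → x ≡ lw
      only-lw {x} wx lx with S⊆kept-list {x} (w-leaf∈S wx lx)
      ... | here refl                         = ⊥-elim (iu lx)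
      ... | there (here refl)                 = ⊥-elim (r-inner lx)
      ... | there (there (here refl))         = ⊥-elim (iw lx)
      ... | there (there (there (here x≡lw))) = x≡lw

      only-lv : ∀ {x} → Adj T v x → Leaf T x → x ≡ lv
      only-lv vx lx = count≤1⇒unique v-leaves≤1 (leavesAt-intro T vx lx) (leavesAt-intro T v-lv lv-leaf)
        where
        v-leaves≤1 : count (leavesAt T v) ≤ 1
        v-leaves≤1 = ≤-trans fewer (count≤length (lw ∷ []) λ _ e → here (uncurry only-lw (leavesAt-elim T e)))

      path : List (Fin n)
      path = lv ∷ v ∷ kept-list

      path-covers : ∀ x → x ∈ path
      path-covers x with S x in x∈S
      ... | true = there (there (S⊆kept-list x∈S))
      ... | false with deleteVLeaves≡false⇒ T {v} {x} x∈S
      ...   | inj₁ x≡v       = there (here x≡v)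
      ...   | inj₂ (vx , lx) = here (only-lv vx lx)

      n≡6 : n ≡ 6
      n≡6 = ≤-antisym (covers⇒n≤length path path-covers) 6≤n

      r-neighbour : ∀ {x} → Adj T r x → x ≡ u ⊎ x ≡ w
      r-neighbour {x} rx with path-covers x
      ... | here refl                   = ⊥-elim (r≢v (leaf-neighbour-unique T lv-leaf (Adj-sym T rx) (Adj-sym T v-lv)))
      ... | there (here refl)           = ⊥-elim (r≢u (only-u r (Adj-sym T rx) r-inner))
      ... | there (there (here refl))   = inj₁ refl
      ... | there (there (there (here refl))) = ⊥-elim (Adj-irrefl T rx)
      ... | there (there (there (there (here refl)))) = inj₂ refl
      ... | there (there (there (there (there (here refl))))) =
        ⊥-elim (r≢w (leaf-neighbour-unique T lw-leaf (Adj-sym T rx) (Adj-sym T w-lw)))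

      r-u : Adj T r u
      r-u with ∃-of-count≥2 (Inner⇒degree≥2 2≤n r-inner) w
      ... | y , ry , y≢w with r-neighbour ry
      ...   | inj₁ refl = ry
      ...   | inj₂ y≡w  = ⊥-elim (y≢w y≡w)

      r-w : Adj T r w
      r-w with ∃-of-count≥2 (Inner⇒degree≥2 2≤n r-inner) u
      ... | y , ry , y≢u with r-neighbour ry
      ...   | inj₁ y≡u  = ⊥-elim (y≢u y≡u)
      ...   | inj₂ refl = ry

      path-unique : Unique path
      path-unique =
        (Adj⇒≢ T (Adj-sym T v-lv) ∷ inner≢leaf iu lv-leaf ∘ ≡.sym ∷ inner≢leaf r-inner lv-leaf ∘ ≡.sym ∷
         inner≢leaf iw lv-leaf ∘ ≡.sym ∷ lv≢lw ∷ []) ∷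
        (Adj⇒≢ T vu ∷ r≢v ∘ ≡.sym ∷ v≢w ∷ inner≢leaf iv lw-leaf ∷ []) ∷ kept-unique
        where
        lv≢lw : lv ≢ lw
        lv≢lw refl = v≢w (leaf-neighbour-unique T lv-leaf (Adj-sym T v-lv) (Adj-sym T w-lw))

      path-linked : Linked (Adj T) path
      path-linked = Adj-sym T v-lv ∷ vu ∷ Adj-sym T r-u ∷ r-w ∷ w-lw ∷ [-]

      isP6 : IsP6 T
      isP6 = n≡6 , lookup path , Unique-lookup-injective path-unique , path-adjacency path-unique path-linked

    Cond1-or-P6 : Cond1 T ⊎ IsP6 T
    Cond1-or-P6 with count S ≤? 4
    ... | yes S≤4 = inj₂ (SmallRemainder.isP6 S≤4)
    ... | no S≰4 with count S ℕ.≟ 5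
    ...   | yes S≡5 = inj₁ (cond1 (inj₂ (S≡5 , not-star)))
    ...   | no S≢5  = inj₁ (cond1 (inj₁ (≤∧≢⇒< (≰⇒> S≰4) (S≢5 ∘ ≡.sym))))

  ends⇒Cond1-or-P6 : ∀ {v w} → Ends v w → Cond1 T ⊎ IsP6 T
  ends⇒Cond1-or-P6 {v} {w} ends with leaf-at (Ends.v-leaf ends) | leaf-at (Ends.w-leaf ends)
  ... | lv , v-lv , lv-leaf | lw , w-lw , lw-leaf with ≤-total (count (leavesAt T v)) (count (leavesAt T w))
  ...   | inj₁ fewer = Deletion.Cond1-or-P6 ends v-lv lv-leaf w-lw lw-leaf fewer
  ...   | inj₂ fewer = Deletion.Cond1-or-P6 (Ends-swap ends) w-lw lw-leaf v-lv lv-leaf fewer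

  from-pendants : (∃₂ λ v u → ∃₂ λ w u′ → InnerLeaf v u × InnerLeaf w u′ × w ≢ v) → Conclusion
  from-pendants (v , u , w , u′ , v-leaf , w-leaf , w≢v) with inner-outside (v ∷ u ∷ w ∷ [])
  ... | inj₂ covered = inj₂ (inj₁ (few-inner⇒Cond2 v-leaf w-leaf w≢v covered))
  ... | inj₁ (r , ir , r∉) with u ≟ w
  ...   | yes refl = ⊥-elim ([ r∉ ∘ here , r∉ ∘ there ∘ here ]′ (pendant-pair⇒two-inner v-leaf w-leaf r ir))
  ...   | no u≢w = [ inj₁ , inj₂ ∘ inj₂ ∘ inj₂ ]′ (ends⇒Cond1-or-P6 record
    { u = u ; u′ = u′ ; r = r ; v-leaf = v-leaf ; w-leaf = w-leaf ; v≢w = w≢v ∘ ≡.sym ; u≢w = u≢w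
    ; r-inner = ir ; r≢v = r∉ ∘ here ; r≢u = r∉ ∘ there ∘ here ; r≢w = r∉ ∘ there ∘ there ∘ here })

lemma11 : (n : ℕ) → n ≥ 6 → (T : Graph n) → IsTree T →
    Cond1 T ⊎ Cond2 T ⊎ (IsStar T ⊎ IsP6 T)
lemma11 n 6≤n T (connected , acyclic) = from-inner (∃-inner 3≤n)
  where
  open Classification connected acyclic 6≤n
  from-inner : ∃ Inner → Conclusion
  from-inner (p , ip) with any? (λ q → (adj T p q Bool.≟ true) ×-dec inner? q)
  ... | yes (q , pq , iq) = from-pendants (two-pendants ip iq pq)
  ... | no none = inj₂ (inj₂ (inj₁ (lone-inner⇒star 3≤n (inner-closed⇒universal (_≡ p) only-p refl ip))))
    where
    only-p : ∀ {a b} → a ≡ p → Inner a → Adj T a b → Inner b → b ≡ p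
    only-p refl _ pb ib = ⊥-elim (none (_ , pb , ib))
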